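{- Let $\mathcal{D}$ be an initial segment of the binary order on $\mathcal{B}(n)$. Then $w(\mathcal{D}) = s(\mathcal{D})$, where $s(\mathcal{D})$ is the number of special points in $\mathcal{D}$.
   Context: $\mathcal{B}(n)$ is the family of all subsets of $[n]=\{1,\dots,n\}$ ordered by inclusion. The binary order $<_b$ on $\mathcal{B}(n)$: $A <_b B$ if $\max(A \triangle B) \in B$. The width $w(\mathcal{X})$ is the maximum size of an antichain (family of pairwise inclusion-incomparable sets) in $\mathcal{X}$. Identify $A \subseteq [n]$ with its 0-1 sequence $a_1 a_2 \cdots a_n$ ($a_j = 1$ iff $j \in A$). Pairing procedure: scan positions from left to right; a scanned 0 becomes (temporarily) unpaired; a scanned 1 is paired with the rightmost currently unpaired 0 to its left, if there is one (both then become paired), and otherwise the 1 remains unpaired. A set $A$ is a special point if its sequence has no unpaired 1's under this procedure. -}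

module Defs where

open import Data.Bool using (Bool; true; false; _∧_; if_then_else_)
open import Data.Nat using (ℕ; zero; suc; _<_; _≤_)
open import Data.Fin using (Fin; toℕ)
open import Data.Fin.Subset using (Subset; _⊆_)
open import Data.Vec using (Vec; []; _∷_; lookup; toList)
open import Data.List using (List; []; _∷_; map; _++_; length; filter)
open import Data.List.Relation.Unary.All using (All)
open import Data.List.Relation.Unary.AllPairs using (AllPairs)
open import Data.Product using (_×_; Σ; ∃)
open import Data.Unit using (⊤)
open import Relation.Binary.PropositionalEquality using (_≡_)
open import Relation.Nullary using (¬_)
open import Relation.Nullary.Decidable using (does)
open import Data.Nat using (_≟_)
open import Data.Bool using () renaming (_≟_ to _≟ᵇ_)

-- A subset A of [n] is a Subset n = Vec Bool n; entry at index i (Fin n)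
-- is true iff element (toℕ i + 1) ∈ A.  Its 0-1 sequence a_1 ... a_n is
-- the vector read left to right.

-- Binary order: A <b B iff max (A △ B) ∈ B, i.e. there is a position j
-- where A and B differ, j ∈ B (so j ∉ A), and A, B agree at all larger positions.
_<b_ : {n : ℕ} → Subset n → Subset n → Set
_<b_ {n} A B = Σ (Fin n) λ j →
  (lookup A j ≡ false) × (lookup B j ≡ true) ×
  ((k : Fin n) → toℕ j < toℕ k → lookup A k ≡ lookup B k)

Family : ℕ → Set
Family n = Subset n → Bool

InitialSegment : {n : ℕ} → Family n → Set
InitialSegment {n} D = (A B : Subset n) → B <b A → D A ≡ true → D B ≡ true

allSubsets : (n : ℕ) → List (Subset n)
allSubsets zero = [] ∷ []
allSubsets (suc n) = map (false ∷_) (allSubsets n) ++ map (true ∷_) (allSubsets n)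

-- The list 'stack' holds the currently unpaired 0's
-- (their positions), most recently scanned (= rightmost) first.
-- 'unpairedOnes pos stack bits' returns the number of 1's left unpaired.
unpairedOnes : ℕ → List ℕ → List Bool → ℕ
unpairedOnes pos stack [] = 0
unpairedOnes pos stack (false ∷ bs) = unpairedOnes (suc pos) (pos ∷ stack) bs
-- a 1 is paired with the rightmost unpaired 0 to its left (head of stack)
unpairedOnes pos (z ∷ stack) (true ∷ bs) = unpairedOnes (suc pos) stack bs
unpairedOnes pos [] (true ∷ bs) = suc (unpairedOnes (suc pos) [] bs)

isSpecial : {n : ℕ} → Subset n → Bool
isSpecial A = does (unpairedOnes 1 [] (toList A) ≟ 0)

s : {n : ℕ} → Family n → ℕ
s {n} D = length (filter (λ A → (D A ∧ isSpecial A) ≟ᵇ true) (allSubsets n))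

Incomparable : {n : ℕ} → Subset n → Subset n → Set
Incomparable A B = ¬ (A ⊆ B) × ¬ (B ⊆ A)

IsAntichainIn : {n : ℕ} → Family n → List (Subset n) → Set
IsAntichainIn D xs = All (λ A → D A ≡ true) xs × AllPairs Incomparable xs

IsWidth : {n : ℕ} → Family n → ℕ → Set
IsWidth {n} D k =
  (Σ (List (Subset n)) λ xs → IsAntichainIn D xs × length xs ≡ k) ×
  ((xs : List (Subset n)) → IsAntichainIn D xs → length xs ≤ k)

-- An antichain in D has at most s(D) elements: deleting the unpaired 1's of A leaves a special
-- point contained in A, which precedes A in the binary order and hence lies in D, and the sets
-- with the same image form a chain, so distinct members of an antichain have distinct images.
--
-- An antichain with s(D) elements is built by recursion on the last coordinate. If D contains ∅1
-- it contains the whole lower half {A0}; there we take the sets A0 with 2|A| + a ∈ {n, n + 1}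
-- and recurse into the upper half with offset a + 1, otherwise we recurse into the lower half with
-- offset a − 1. Sets of the recursive part satisfy 2|A| + a + 1 ≤ n, so none of them contains a
-- set on the level. The count is right because the level with offset a has as many sets as there
-- are special points with at least a − 1 unpaired 0's (a ballot-type identity), and appending a
-- 0 or a 1 moves the number of unpaired 0's exactly as the offset moves.
module Submission where

open import Defs
open import Data.Bool as Bool using (Bool; true; false; _∧_; if_then_else_; f≤t; b≤b)
open import Data.Bool.Properties using (∧-identityʳ; ∧-zeroʳ; T-≡) renaming (_≟_ to _≟ᵇ_)
open import Data.Empty using (⊥-elim)
open import Data.Fin using () renaming (zero to fzero; suc to fsuc)
open import Data.Fin.Subset using (Subset; _⊆_; ∁; ∣_∣) renaming (⊥ to ∅)
open import Data.Fin.Subset.Properties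
  using (drop-∷-⊆; out⊆; s⊆s; ⊆-refl; ⊥⊆; ∣p∣≤n; ∣∁p∣≡n∸∣p∣; p⊆q⇒∣p∣≤∣q∣)
open import Data.List using (List; []; _∷_; map; _++_; length; filter)
open import Data.List.Properties using (filter-++; length-++; length-map; length-removeAt′)
open import Data.List.Membership.Propositional using (_∈_)
open import Data.List.Membership.Propositional.Properties
  using (∈-map⁺; ∈-map⁻; ∈-++⁺ˡ; ∈-++⁺ʳ; ∈-filter⁺)
open import Data.List.Relation.Unary.All as All using (All; []; _∷_)
open import Data.List.Relation.Unary.All.Properties using (all-filter) renaming (map⁺ to All-map⁺)
open import Data.List.Relation.Unary.AllPairs as AllPairs using (AllPairs; []; _∷_)
import Data.List.Relation.Unary.AllPairs.Properties as AllPairsₚ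
open import Data.List.Relation.Unary.Any using (here; there; index; _─_)
open import Data.List.Relation.Unary.Unique.Propositional using (Unique)
import Data.List.Relation.Unary.Unique.Propositional.Properties as Uniqueₚ
open import Data.Nat
  using (ℕ; zero; suc; _+_; _∸_; _<_; _≤_; z≤n; s≤s; s≤s⁻¹; _≤ᵇ_; _≡ᵇ_; pred; _≤?_)
open import Data.Nat.Properties
  using (+-comm; +-suc; +-identityʳ; +-cancelˡ-≤; +-cancelʳ-≤; +-monoˡ-≤; +-monoʳ-≤; +-mono-≤;
         m∸n+n≡m; m≤n+m∸n; ≤-trans; ≤-reflexive; ≮⇒≥; <-irrefl; pred-mono-≤; n≤0⇒n≡0;
         suc-injective; +-commutativeSemigroup; module ≤-Reasoning)
open import Algebra.Properties.CommutativeSemigroup +-commutativeSemigroup using (interchange)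
open import Data.Nat.Tactic.RingSolver using (solve-∀)
open import Data.Product using (_×_; _,_; proj₁; proj₂)
import Data.Product as Product
open import Data.Sum using (_⊎_; inj₁; inj₂; swap)
import Data.Sum as Sum
open import Data.Vec using ([]; _∷_; _∷ʳ_; lookup; toList; init; last; initLast)
import Data.Vec as Vec
open import Data.Vec.Properties
  using (tabulate∘lookup; tabulate-cong; init-∷ʳ; last-∷ʳ; ∷ʳ-injective; ∷-injectiveʳ)
open import Function.Bundles using (_⇔_; mk⇔; Equivalence)
open import Relation.Binary.PropositionalEquality
  using (_≡_; _≢_; refl; sym; trans; cong; cong₂; module ≡-Reasoning)
open import Relation.Nullary using (¬_)
open import Relation.Nullary.Decidable using (Dec; does; _×-dec_; does-⇔; toWitness; isYes≗does)

∈-─⁺ : ∀ {X : Set} {x y : X} {ys : List X} (x∈ys : x ∈ ys) → x ≢ y → y ∈ ys → y ∈ (ys ─ x∈ys)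
∈-─⁺ (here refl) x≢y (here refl) = ⊥-elim (x≢y refl)
∈-─⁺ (here _)    _   (there y∈ys) = y∈ys
∈-─⁺ (there _)   _   (here refl)  = here refl
∈-─⁺ (there x∈ys) x≢y (there y∈ys) = there (∈-─⁺ x∈ys x≢y y∈ys)

unique-length≤ : ∀ {X : Set} {xs ys : List X} → Unique xs → All (_∈ ys) xs → length xs ≤ length ys
unique-length≤ []                  []                = z≤n
unique-length≤ {ys = ys} (x≢xs ∷ xs-unique) (x∈ys ∷ xs⊆ys) = ≤-trans
  (s≤s (unique-length≤ xs-unique (All.zipWith (λ (x≢z , z∈ys) → ∈-─⁺ x∈ys x≢z z∈ys) (x≢xs , xs⊆ys))))
  (≤-reflexive (sym (length-removeAt′ ys (index x∈ys))))

AllPairs-mapWithAll : ∀ {X : Set} {P : X → Set} {R S : X → X → Set} {xs : List X} →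
  (∀ {x y} → P x → P y → R x y → S x y) → All P xs → AllPairs R xs → AllPairs S xs
AllPairs-mapWithAll f []         []         = []
AllPairs-mapWithAll f (px ∷ pxs) (rx ∷ rxs) =
  All.zipWith (λ (py , r) → f px py r) (pxs , rx) ∷ AllPairs-mapWithAll f pxs rxs

-- Phrased through filter so that s D is literally countSubsets n (λ A → D A ∧ isSpecial A).
count : {X : Set} → (X → Bool) → List X → ℕ
count p xs = length (filter (λ x → p x ≟ᵇ true) xs)

count-++ : {X : Set} (p : X → Bool) (xs ys : List X) →
           count p (xs ++ ys) ≡ count p xs + count p ys
count-++ p xs ys = trans (cong length (filter-++ _ xs ys)) (length-++ (filter _ xs))

count-map : {X Y : Set} (p : Y → Bool) (f : X → Y) (xs : List X) →
            count p (map f xs) ≡ count (λ x → p (f x)) xs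
count-map p f [] = refl
count-map p f (x ∷ xs) with p (f x)
... | true  = cong suc (count-map p f xs)
... | false = count-map p f xs

count-cong : {X : Set} {p q : X → Bool} → (∀ x → p x ≡ q x) → (xs : List X) →
             count p xs ≡ count q xs
count-cong p≗q [] = refl
count-cong {p = p} {q} p≗q (x ∷ xs) with p x | q x | p≗q x
... | true  | true  | refl = cong suc (count-cong p≗q xs)
... | false | false | refl = count-cong p≗q xs

count-false : {X : Set} (xs : List X) → count (λ _ → false) xs ≡ 0
count-false [] = refl
count-false (x ∷ xs) = count-false xs

∈-allSubsets : ∀ {n} (A : Subset n) → A ∈ allSubsets n
∈-allSubsets []          = here refl
∈-allSubsets (false ∷ A) = ∈-++⁺ˡ (∈-map⁺ (false ∷_) (∈-allSubsets A))
∈-allSubsets {suc n} (true ∷ A) =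
  ∈-++⁺ʳ (map (false ∷_) (allSubsets n)) (∈-map⁺ (true ∷_) (∈-allSubsets A))

allSubsets-unique : ∀ n → Unique (allSubsets n)
allSubsets-unique zero    = [] ∷ []
allSubsets-unique (suc n) = Uniqueₚ.++⁺ (Uniqueₚ.map⁺ ∷-injectiveʳ (allSubsets-unique n))
                                        (Uniqueₚ.map⁺ ∷-injectiveʳ (allSubsets-unique n)) disjoint
  where
  disjoint : ∀ {A} → ¬ (A ∈ map (false ∷_) (allSubsets n) × A ∈ map (true ∷_) (allSubsets n))
  disjoint (A∈₀ , A∈₁) with ∈-map⁻ (false ∷_) A∈₀ | ∈-map⁻ (true ∷_) A∈₁
  ... | _ , _ , refl | _ , _ , ()

countSubsets : (n : ℕ) → (Subset n → Bool) → ℕ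
countSubsets n p = count p (allSubsets n)

countSubsets-cong : ∀ n {p q : Subset n → Bool} → (∀ A → p A ≡ q A) →
                    countSubsets n p ≡ countSubsets n q
countSubsets-cong n p≗q = count-cong p≗q (allSubsets n)

countSubsets-∷ : ∀ n (p : Subset (suc n) → Bool) →
  countSubsets (suc n) p ≡ countSubsets n (λ A → p (false ∷ A)) + countSubsets n (λ A → p (true ∷ A))
countSubsets-∷ n p = trans (count-++ p (map (false ∷_) (allSubsets n)) _)
  (cong₂ _+_ (count-map p (false ∷_) (allSubsets n)) (count-map p (true ∷_) (allSubsets n)))

countSubsets-∷ʳ : ∀ n (p : Subset (suc n) → Bool) →
  countSubsets (suc n) p ≡ countSubsets n (λ A → p (A ∷ʳ false)) + countSubsets n (λ A → p (A ∷ʳ true))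
countSubsets-∷ʳ zero p = trans (countSubsets-∷ 0 p) (cong₂ _+_ (at[] false) (at[] true))
  where
  at[] : ∀ b → countSubsets 0 (λ A → p (b ∷ A)) ≡ countSubsets 0 (λ A → p (A ∷ʳ b))
  at[] b = countSubsets-cong 0 {λ A → p (b ∷ A)} {λ A → p (A ∷ʳ b)} λ { [] → refl }
countSubsets-∷ʳ (suc n) p = begin
  countSubsets (suc (suc n)) p
    ≡⟨ countSubsets-∷ (suc n) p ⟩
  # (λ A → p (false ∷ A)) + # (λ A → p (true ∷ A))
    ≡⟨ cong₂ _+_ (countSubsets-∷ʳ n (λ A → p (false ∷ A))) (countSubsets-∷ʳ n (λ A → p (true ∷ A))) ⟩
  (#′ (λ A → p (false ∷ (A ∷ʳ false))) + #′ (λ A → p (false ∷ (A ∷ʳ true)))) +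
  (#′ (λ A → p (true ∷ (A ∷ʳ false))) + #′ (λ A → p (true ∷ (A ∷ʳ true))))
    ≡⟨ interchange (#′ (λ A → p (false ∷ (A ∷ʳ false)))) (#′ (λ A → p (false ∷ (A ∷ʳ true))))
                   (#′ (λ A → p (true ∷ (A ∷ʳ false)))) (#′ (λ A → p (true ∷ (A ∷ʳ true)))) ⟩
  (#′ (λ A → p (false ∷ (A ∷ʳ false))) + #′ (λ A → p (true ∷ (A ∷ʳ false)))) +
  (#′ (λ A → p (false ∷ (A ∷ʳ true))) + #′ (λ A → p (true ∷ (A ∷ʳ true))))
    ≡⟨ sym (cong₂ _+_ (countSubsets-∷ n (λ A → p (A ∷ʳ false)))
                      (countSubsets-∷ n (λ A → p (A ∷ʳ true)))) ⟩
  # (λ A → p (A ∷ʳ false)) + # (λ A → p (A ∷ʳ true)) ∎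
  where
  open ≡-Reasoning
  # = countSubsets (suc n)
  #′ = countSubsets n

countSubsets-∁ : ∀ n (p : Subset n → Bool) → countSubsets n (λ A → p (∁ A)) ≡ countSubsets n p
countSubsets-∁ zero p = countSubsets-cong 0 {λ A → p (∁ A)} {p} λ { [] → refl }
countSubsets-∁ (suc n) p = begin
  countSubsets (suc n) (λ A → p (∁ A))
    ≡⟨ countSubsets-∷ n (λ A → p (∁ A)) ⟩
  countSubsets n (λ A → p (true ∷ ∁ A)) + countSubsets n (λ A → p (false ∷ ∁ A))
    ≡⟨ cong₂ _+_ (countSubsets-∁ n (λ A → p (true ∷ A))) (countSubsets-∁ n (λ A → p (false ∷ A))) ⟩
  countSubsets n (λ A → p (true ∷ A)) + countSubsets n (λ A → p (false ∷ A))
    ≡⟨ +-comm (countSubsets n (λ A → p (true ∷ A))) (countSubsets n (λ A → p (false ∷ A))) ⟩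
  countSubsets n (λ A → p (false ∷ A)) + countSubsets n (λ A → p (true ∷ A))
    ≡⟨ sym (countSubsets-∷ n p) ⟩
  countSubsets (suc n) p ∎
  where open ≡-Reasoning

∣∷ʳfalse∣ : ∀ {n} (A : Subset n) → ∣ A ∷ʳ false ∣ ≡ ∣ A ∣
∣∷ʳfalse∣ []          = refl
∣∷ʳfalse∣ (false ∷ A) = ∣∷ʳfalse∣ A
∣∷ʳfalse∣ (true ∷ A)  = cong suc (∣∷ʳfalse∣ A)

∣∷ʳtrue∣ : ∀ {n} (A : Subset n) → ∣ A ∷ʳ true ∣ ≡ suc ∣ A ∣
∣∷ʳtrue∣ []          = refl
∣∷ʳtrue∣ (false ∷ A) = ∣∷ʳtrue∣ A
∣∷ʳtrue∣ (true ∷ A)  = cong suc (∣∷ʳtrue∣ A)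

∣∁A∣+∣A∣≡n : ∀ {n} (A : Subset n) → ∣ ∁ A ∣ + ∣ A ∣ ≡ n
∣∁A∣+∣A∣≡n {n} A = trans (cong (_+ ∣ A ∣) (∣∁p∣≡n∸∣p∣ A)) (m∸n+n≡m (∣p∣≤n A))

∷-⊆-∷ : ∀ {n} {a b} {A B : Subset n} → a Bool.≤ b → A ⊆ B → (a ∷ A) ⊆ (b ∷ B)
∷-⊆-∷ f≤t A⊆B = out⊆ A⊆B
∷-⊆-∷ b≤b A⊆B = s⊆s A⊆B

∷-⊆-∷⁻ : ∀ {n} {a b} {A B : Subset n} → (a ∷ A) ⊆ (b ∷ B) → a Bool.≤ b
∷-⊆-∷⁻ {a = false} {false} _ = b≤b
∷-⊆-∷⁻ {a = false} {true}  _ = f≤t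
∷-⊆-∷⁻ {a = true}  {true}  _ = b≤b
∷-⊆-∷⁻ {a = true}  {false} h with h Vec.here
... | ()

∷ʳ-⊆-∷ʳ : ∀ {n} {x y} {A B : Subset n} → A ⊆ B → x Bool.≤ y → (A ∷ʳ x) ⊆ (B ∷ʳ y)
∷ʳ-⊆-∷ʳ {A = []}    {[]}    _   x≤y = ∷-⊆-∷ x≤y ⊆-refl
∷ʳ-⊆-∷ʳ {A = _ ∷ _} {_ ∷ _} A⊆B x≤y = ∷-⊆-∷ (∷-⊆-∷⁻ A⊆B) (∷ʳ-⊆-∷ʳ (drop-∷-⊆ A⊆B) x≤y)

∷ʳ-⊆-∷ʳ⁻ : ∀ {n} {x y} {A B : Subset n} → (A ∷ʳ x) ⊆ (B ∷ʳ y) → A ⊆ B × x Bool.≤ y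
∷ʳ-⊆-∷ʳ⁻ {A = []}    {[]}    h = ⊆-refl , ∷-⊆-∷⁻ h
∷ʳ-⊆-∷ʳ⁻ {A = _ ∷ _} {_ ∷ _} h with ∷ʳ-⊆-∷ʳ⁻ (drop-∷-⊆ h)
... | A⊆B , x≤y = ∷-⊆-∷ (∷-⊆-∷⁻ h) A⊆B , x≤y

⊆∧∣∣≥⇒≡ : ∀ {n} {A B : Subset n} → A ⊆ B → ∣ B ∣ ≤ ∣ A ∣ → A ≡ B
⊆∧∣∣≥⇒≡ {A = []}    {[]}    _ _ = refl
⊆∧∣∣≥⇒≡ {A = a ∷ A} {b ∷ B} h ∣B∣≤∣A∣ with ∷-⊆-∷⁻ h
⊆∧∣∣≥⇒≡ {A = false ∷ A} {false ∷ B} h ∣B∣≤∣A∣ | b≤b = cong (false ∷_) (⊆∧∣∣≥⇒≡ (drop-∷-⊆ h) ∣B∣≤∣A∣)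
⊆∧∣∣≥⇒≡ {A = true ∷ A}  {true ∷ B}  h ∣B∣≤∣A∣ | b≤b =
  cong (true ∷_) (⊆∧∣∣≥⇒≡ (drop-∷-⊆ h) (s≤s⁻¹ ∣B∣≤∣A∣))
⊆∧∣∣≥⇒≡ {A = false ∷ A} {true ∷ B}  h ∣B∣≤∣A∣ | f≤t =
  ⊥-elim (<-irrefl refl (≤-trans (s≤s (p⊆q⇒∣p∣≤∣q∣ (drop-∷-⊆ h))) ∣B∣≤∣A∣))

<b-here : ∀ {n} (A : Subset n) → (false ∷ A) <b (true ∷ A)
<b-here A = fzero , refl , refl , λ { fzero () ; (fsuc k) _ → refl }

<b-there : ∀ {n} {A B : Subset n} a b → A <b B → (a ∷ A) <b (b ∷ B)
<b-there a b (j , A[j] , B[j] , above) =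
  fsuc j , A[j] , B[j] , λ { fzero () ; (fsuc k) j<k → above k (s≤s⁻¹ j<k) }

<b-∷⁻ : ∀ {n} {A B : Subset n} {a b} → (a ∷ A) <b (b ∷ B) →
        A <b B ⊎ (A ≡ B × a ≡ false × b ≡ true)
<b-∷⁻ {A = A} {B} (fzero , a≡false , b≡true , above) =
  inj₂ (lookup-ext (λ k → above (fsuc k) (s≤s z≤n)) , a≡false , b≡true)
  where
  lookup-ext : (∀ k → lookup A k ≡ lookup B k) → A ≡ B
  lookup-ext A≗B = trans (sym (tabulate∘lookup A)) (trans (tabulate-cong A≗B) (tabulate∘lookup B))
<b-∷⁻ (fsuc j , A[j] , B[j] , above) = inj₁ (j , A[j] , B[j] , λ k j<k → above (fsuc k) (s≤s j<k))

<b-∷ʳ : ∀ {n} (A B : Subset n) x → A <b B → (A ∷ʳ x) <b (B ∷ʳ x)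
<b-∷ʳ (a ∷ A) (b ∷ B) x A<B with <b-∷⁻ A<B
... | inj₁ A<B′ = <b-there a b (<b-∷ʳ A B x A<B′)
... | inj₂ (refl , refl , refl) = <b-here (A ∷ʳ x)

∷ʳ-false<b∷ʳ-true : ∀ {n} (A B : Subset n) → (A ∷ʳ false) <b (B ∷ʳ true)
∷ʳ-false<b∷ʳ-true []      []      = <b-here []
∷ʳ-false<b∷ʳ-true (a ∷ A) (b ∷ B) = <b-there a b (∷ʳ-false<b∷ʳ-true A B)

⊆⇒≡⊎<b : ∀ {n} {A B : Subset n} → A ⊆ B → A ≡ B ⊎ A <b B
⊆⇒≡⊎<b {A = []}    {[]}    _ = inj₁ refl
⊆⇒≡⊎<b {A = a ∷ A} {b ∷ B} h with ⊆⇒≡⊎<b (drop-∷-⊆ h) | ∷-⊆-∷⁻ h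
... | inj₂ A<B | _   = inj₂ (<b-there a b A<B)
... | inj₁ refl | b≤b = inj₁ refl
... | inj₁ refl | f≤t = inj₂ (<b-here A)

lowerHalf upperHalf : ∀ {n} → Family (suc n) → Family n
lowerHalf D A = D (A ∷ʳ false)
upperHalf D A = D (A ∷ʳ true)

caseLast : ∀ {n} → Family n → Family n → Family (suc n)
caseLast F G A = if last A then G (init A) else F (init A)

caseLast-∷ʳ : ∀ {n} (F G : Family n) A x → caseLast F G (A ∷ʳ x) ≡ (if x then G A else F A)
caseLast-∷ʳ F G A x rewrite init-∷ʳ x A | last-∷ʳ x A = refl

caseLast-false : ∀ {n} (F G : Family n) A → caseLast F G (A ∷ʳ false) ≡ true → F A ≡ true
caseLast-false F G A = trans (sym (caseLast-∷ʳ F G A false))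

caseLast-true : ∀ {n} (F G : Family n) A → caseLast F G (A ∷ʳ true) ≡ true → G A ≡ true
caseLast-true F G A = trans (sym (caseLast-∷ʳ F G A true))

countSubsets-caseLast : ∀ n (F G : Family n) →
  countSubsets (suc n) (caseLast F G) ≡ countSubsets n F + countSubsets n G
countSubsets-caseLast n F G = trans (countSubsets-∷ʳ n (caseLast F G))
  (cong₂ _+_ (countSubsets-cong n (λ A → caseLast-∷ʳ F G A false))
             (countSubsets-cong n (λ A → caseLast-∷ʳ F G A true)))

lowerHalf-initial : ∀ {n} {D : Family (suc n)} → InitialSegment D → InitialSegment (lowerHalf D)
lowerHalf-initial D-init A B B<A = D-init (A ∷ʳ false) (B ∷ʳ false) (<b-∷ʳ B A false B<A)

upperHalf-initial : ∀ {n} {D : Family (suc n)} → InitialSegment D → InitialSegment (upperHalf D)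
upperHalf-initial D-init A B B<A = D-init (A ∷ʳ true) (B ∷ʳ true) (<b-∷ʳ B A true B<A)

initial-⊆ : ∀ {n} {D : Family n} → InitialSegment D → ∀ {A B} → A ⊆ B → D B ≡ true → D A ≡ true
initial-⊆ D-init A⊆B B∈D with ⊆⇒≡⊎<b A⊆B
... | inj₁ refl = B∈D
... | inj₂ A<B  = D-init _ _ A<B B∈D

lowerHalf-full : ∀ {n} {D : Family (suc n)} → InitialSegment D →
                 D (∅ ∷ʳ true) ≡ true → ∀ A → lowerHalf D A ≡ true
lowerHalf-full D-init ∅₁∈D A = D-init (∅ ∷ʳ true) (A ∷ʳ false) (∷ʳ-false<b∷ʳ-true A ∅) ∅₁∈D

upperHalf-empty : ∀ {n} {D : Family (suc n)} → InitialSegment D →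
                  D (∅ ∷ʳ true) ≡ false → ∀ A → upperHalf D A ≡ false
upperHalf-empty {D = D} D-init ∅₁∉D A with D (A ∷ʳ true) in A₁∈D
... | false = refl
... | true  with trans (sym (initial-⊆ D-init (∷ʳ-⊆-∷ʳ ⊥⊆ b≤b) A₁∈D)) ∅₁∉D
...   | ()

-- The pairing procedure

-- The state is (unpaired 1's so far, currently unpaired 0's).
pairStep : ℕ × ℕ → Bool → ℕ × ℕ
pairStep (u , z)     false = u , suc z
pairStep (u , zero)  true  = suc u , zero
pairStep (u , suc z) true  = u , z

pairing : ∀ {n} → ℕ × ℕ → Subset n → ℕ × ℕ
pairing s []      = s
pairing s (b ∷ A) = pairing (pairStep s b) A

pairing-∷ʳ : ∀ {n} s (A : Subset n) b → pairing s (A ∷ʳ b) ≡ pairStep (pairing s A) b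
pairing-∷ʳ s []      b = refl
pairing-∷ʳ s (x ∷ A) b = pairing-∷ʳ (pairStep s x) A b

unpaired1s unpaired0s : ∀ {n} → Subset n → ℕ
unpaired1s A = proj₁ (pairing (0 , 0) A)
unpaired0s A = proj₂ (pairing (0 , 0) A)

unpairedOnes-pairing : ∀ {n} pos stack (A : Subset n) u →
  unpairedOnes pos stack (toList A) + u ≡ proj₁ (pairing (u , length stack) A)
unpairedOnes-pairing pos stack       []          u = refl
unpairedOnes-pairing pos stack       (false ∷ A) u = unpairedOnes-pairing (suc pos) (pos ∷ stack) A u
unpairedOnes-pairing pos (_ ∷ stack) (true ∷ A)  u = unpairedOnes-pairing (suc pos) stack A u
unpairedOnes-pairing pos []          (true ∷ A)  u =
  trans (sym (+-suc _ u)) (unpairedOnes-pairing (suc pos) [] A (suc u))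

isSpecial≡unpaired1s≡ᵇ0 : ∀ {n} (A : Subset n) → isSpecial A ≡ (unpaired1s A ≡ᵇ 0)
isSpecial≡unpaired1s≡ᵇ0 A =
  cong (_≡ᵇ 0) (trans (sym (+-identityʳ _)) (unpairedOnes-pairing 1 [] A 0))

unpaired0s-∷ʳ-false : ∀ {n} (A : Subset n) → unpaired0s (A ∷ʳ false) ≡ suc (unpaired0s A)
unpaired0s-∷ʳ-false A = cong proj₂ (pairing-∷ʳ (0 , 0) A false)

unpaired0s-∷ʳ-true : ∀ {n} (A : Subset n) → unpaired0s (A ∷ʳ true) ≡ pred (unpaired0s A)
unpaired0s-∷ʳ-true A rewrite pairing-∷ʳ (0 , 0) A true with pairing (0 , 0) A
... | u , zero  = refl
... | u , suc z = refl

special≥ : ∀ {n} → ℕ → Subset n → Bool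
special≥ c A = (unpaired1s A ≡ᵇ 0) ∧ (c ≤ᵇ unpaired0s A)

special≥-zero : ∀ {n} (A : Subset n) → special≥ 0 A ≡ isSpecial A
special≥-zero A = trans (∧-identityʳ _) (sym (isSpecial≡unpaired1s≡ᵇ0 A))

≤ᵇ-suc : ∀ c z → (suc c ≤ᵇ suc z) ≡ (c ≤ᵇ z)
≤ᵇ-suc zero    z = refl
≤ᵇ-suc (suc c) z = refl

≤ᵇ-pred : ∀ c z → (c ≤ᵇ suc z) ≡ (c ∸ 1 ≤ᵇ z)
≤ᵇ-pred zero    z = refl
≤ᵇ-pred (suc c) z = ≤ᵇ-suc c z

special≥-∷ʳ-false : ∀ {n} c (A : Subset n) → special≥ c (A ∷ʳ false) ≡ special≥ (c ∸ 1) A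
special≥-∷ʳ-false c A rewrite pairing-∷ʳ (0 , 0) A false with pairing (0 , 0) A
... | u , z = cong ((u ≡ᵇ 0) ∧_) (≤ᵇ-pred c z)

special≥-∷ʳ-true : ∀ {n} c (A : Subset n) → special≥ c (A ∷ʳ true) ≡ special≥ (suc c) A
special≥-∷ʳ-true c A rewrite pairing-∷ʳ (0 , 0) A true with pairing (0 , 0) A
... | u , zero  = sym (∧-zeroʳ (u ≡ᵇ 0))
... | u , suc z = cong ((u ≡ᵇ 0) ∧_) (sym (≤ᵇ-suc c z))

#special≥ : ℕ → ℕ → ℕ
#special≥ n c = countSubsets n (special≥ c)

#special≥-suc : ∀ n c → #special≥ (suc n) c ≡ #special≥ n (c ∸ 1) + #special≥ n (suc c)
#special≥-suc n c = trans (countSubsets-∷ʳ n (special≥ c))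
  (cong₂ _+_ (countSubsets-cong n (special≥-∷ʳ-false c)) (countSubsets-cong n (special≥-∷ʳ-true c)))

#special≥In : ∀ {n} → ℕ → Family n → ℕ
#special≥In {n} c D = countSubsets n (λ A → D A ∧ special≥ c A)

#special≥In-suc : ∀ {n} c (D : Family (suc n)) →
  #special≥In c D ≡ #special≥In (c ∸ 1) (lowerHalf D) + #special≥In (suc c) (upperHalf D)
#special≥In-suc {n} c D = trans (countSubsets-∷ʳ n (λ A → D A ∧ special≥ c A))
  (cong₂ _+_ (countSubsets-cong n (λ A → cong (D (A ∷ʳ false) ∧_) (special≥-∷ʳ-false c A)))
             (countSubsets-cong n (λ A → cong (D (A ∷ʳ true) ∧_) (special≥-∷ʳ-true c A))))

#special≥In-full : ∀ {n} c (D : Family n) → (∀ A → D A ≡ true) → #special≥In c D ≡ #special≥ n c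
#special≥In-full {n} c D full = countSubsets-cong n (λ A → cong (_∧ special≥ c A) (full A))

#special≥In-empty : ∀ {n} c (D : Family n) → (∀ A → D A ≡ false) → #special≥In c D ≡ 0
#special≥In-empty {n} c D empty =
  trans (countSubsets-cong n (λ A → cong (_∧ special≥ c A) (empty A))) (count-false (allSubsets n))

-- Upper bound: deleting the unpaired 1's

-- A 1 is kept iff an unpaired 0 is available to its left; z counts those 0's.
pairedFrom : ∀ {n} → ℕ → Subset n → Subset n
pairedFrom z       []          = []
pairedFrom z       (false ∷ A) = false ∷ pairedFrom (suc z) A
pairedFrom zero    (true ∷ A)  = false ∷ pairedFrom zero A
pairedFrom (suc z) (true ∷ A)  = true ∷ pairedFrom z A

paired1s : ∀ {n} → Subset n → Subset n
paired1s = pairedFrom 0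

keptBit : Bool → ℕ → Bool
keptBit false _       = false
keptBit true  zero    = false
keptBit true  (suc _) = true

pairedFrom-∷ʳ : ∀ {n} u z (A : Subset n) b →
  pairedFrom z (A ∷ʳ b) ≡ pairedFrom z A ∷ʳ keptBit b (proj₂ (pairing (u , z) A))
pairedFrom-∷ʳ u zero    []          false = refl
pairedFrom-∷ʳ u (suc z) []          false = refl
pairedFrom-∷ʳ u zero    []          true  = refl
pairedFrom-∷ʳ u (suc z) []          true  = refl
pairedFrom-∷ʳ u z       (false ∷ A) b     = cong (false ∷_) (pairedFrom-∷ʳ u (suc z) A b)
pairedFrom-∷ʳ u zero    (true ∷ A)  b     = cong (false ∷_) (pairedFrom-∷ʳ (suc u) zero A b)
pairedFrom-∷ʳ u (suc z) (true ∷ A)  b     = cong (true ∷_) (pairedFrom-∷ʳ u z A b)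

paired1s-∷ʳ : ∀ {n} (A : Subset n) b → paired1s (A ∷ʳ b) ≡ paired1s A ∷ʳ keptBit b (unpaired0s A)
paired1s-∷ʳ = pairedFrom-∷ʳ 0 0

-- The 0's replacing deleted 1's stay unpaired; k counts them.
pairedFrom-unpaired1s : ∀ {n} z k (A : Subset n) → proj₁ (pairing (0 , z + k) (pairedFrom z A)) ≡ 0
pairedFrom-unpaired1s z       k []          = refl
pairedFrom-unpaired1s z       k (false ∷ A) = pairedFrom-unpaired1s (suc z) k A
pairedFrom-unpaired1s zero    k (true ∷ A)  = pairedFrom-unpaired1s zero (suc k) A
pairedFrom-unpaired1s (suc z) k (true ∷ A)  = pairedFrom-unpaired1s z k A

paired1s-special : ∀ {n} (A : Subset n) → isSpecial (paired1s A) ≡ true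
paired1s-special A =
  trans (isSpecial≡unpaired1s≡ᵇ0 (paired1s A)) (cong (_≡ᵇ 0) (pairedFrom-unpaired1s 0 0 A))

pairedFrom-⊆ : ∀ {n} z (A : Subset n) → pairedFrom z A ⊆ A
pairedFrom-⊆ z       []          = ⊆-refl
pairedFrom-⊆ z       (false ∷ A) = out⊆ (pairedFrom-⊆ (suc z) A)
pairedFrom-⊆ zero    (true ∷ A)  = out⊆ (pairedFrom-⊆ zero A)
pairedFrom-⊆ (suc z) (true ∷ A)  = s⊆s (pairedFrom-⊆ z A)

-- B is above A on the chain of sets with the same paired 1's; going up turns unpaired 0's into 1's.
_≼_ : ∀ {n} → Subset n → Subset n → Set
A ≼ B = A ⊆ B × unpaired0s B ≤ unpaired0s A × (unpaired0s A ≡ unpaired0s B → A ≡ B)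

≼-∷ʳ : ∀ {n} {A B : Subset n} a b → A ≼ B → keptBit a (unpaired0s A) ≡ keptBit b (unpaired0s B) →
       (A ∷ʳ a) ≼ (B ∷ʳ b) ⊎ (B ∷ʳ b) ≼ (A ∷ʳ a)
≼-∷ʳ {A = A} {B} false false (A⊆B , zB≤zA , zA≡zB⇒A≡B) _
  rewrite unpaired0s-∷ʳ-false A | unpaired0s-∷ʳ-false B =
  inj₁ (∷ʳ-⊆-∷ʳ A⊆B b≤b , s≤s zB≤zA , λ e → cong (_∷ʳ false) (zA≡zB⇒A≡B (suc-injective e)))
≼-∷ʳ {A = A} {B} true true (A⊆B , zB≤zA , zA≡zB⇒A≡B) kept
  rewrite unpaired0s-∷ʳ-true A | unpaired0s-∷ʳ-true B =
  inj₁ (∷ʳ-⊆-∷ʳ A⊆B b≤b , pred-mono-≤ zB≤zA ,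
        λ e → cong (_∷ʳ true) (zA≡zB⇒A≡B (pred-injective _ _ kept e)))
  where
  pred-injective : ∀ x y → keptBit true x ≡ keptBit true y → pred x ≡ pred y → x ≡ y
  pred-injective zero    zero    _ _ = refl
  pred-injective (suc x) (suc y) _ e = cong suc e
≼-∷ʳ {A = A} {B} false true (A⊆B , _ , _) kept
  rewrite unpaired0s-∷ʳ-false A | unpaired0s-∷ʳ-true B with unpaired0s B
... | zero = inj₁ (∷ʳ-⊆-∷ʳ A⊆B f≤t , z≤n , λ ())
≼-∷ʳ {A = A} {B} true false (A⊆B , zB≤zA , zA≡zB⇒A≡B) kept with unpaired0s A in zA≡0
... | zero with zA≡zB⇒A≡B (sym (n≤0⇒n≡0 zB≤zA))
...   | refl rewrite unpaired0s-∷ʳ-false A | unpaired0s-∷ʳ-true A | zA≡0 =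
  inj₂ (∷ʳ-⊆-∷ʳ ⊆-refl f≤t , z≤n , λ ())

paired1s≡⇒≼⊎≽ : ∀ {n} (A B : Subset n) → paired1s A ≡ paired1s B → A ≼ B ⊎ B ≼ A
paired1s≡⇒≼⊎≽ {zero} [] [] _ = inj₁ (⊆-refl , z≤n , λ _ → refl)
paired1s≡⇒≼⊎≽ {suc n} A B e with initLast A | initLast B
... | A′ , a , refl | B′ , b , refl
  with ∷ʳ-injective (paired1s A′) (paired1s B′)
         (trans (sym (paired1s-∷ʳ A′ a)) (trans e (paired1s-∷ʳ B′ b)))
... | e′ , kept with paired1s≡⇒≼⊎≽ A′ B′ e′
... | inj₁ A′≼B′ = ≼-∷ʳ a b A′≼B′ kept
... | inj₂ B′≼A′ = swap (≼-∷ʳ b a B′≼A′ (sym kept))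

paired1s≡⇒comparable : ∀ {n} (A B : Subset n) → paired1s A ≡ paired1s B → A ⊆ B ⊎ B ⊆ A
paired1s≡⇒comparable A B e = Sum.map proj₁ proj₁ (paired1s≡⇒≼⊎≽ A B e)

antichain-length≤s : ∀ {n} {D : Family n} → InitialSegment D →
                     ∀ xs → IsAntichainIn D xs → length xs ≤ s D
antichain-length≤s {n} {D} D-init xs (xs⊆D , xs-incomparable) =
  ≤-trans (≤-reflexive (sym (length-map paired1s xs))) (unique-length≤ images-unique images-special)
  where
  images-unique : Unique (map paired1s xs)
  images-unique = AllPairsₚ.map⁺ (AllPairs.map (λ {A} {B} (A⊈B , B⊈A) e →
    Sum.[ A⊈B , B⊈A ] (paired1s≡⇒comparable A B e)) xs-incomparable)
  images-special : All (_∈ filter (λ A → (D A ∧ isSpecial A) ≟ᵇ true) (allSubsets n)) (map paired1s xs)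
  images-special = All-map⁺ (All.map (λ {A} A∈D → ∈-filter⁺ (λ A → (D A ∧ isSpecial A) ≟ᵇ true)
    (∈-allSubsets (paired1s A))
    (cong₂ _∧_ (initial-⊆ D-init (pairedFrom-⊆ 0 A) A∈D) (paired1s-special A))) xs⊆D)

-- Levels and the ballot identity

Level : ℕ → ℕ → Set
Level n m = n ≤ m × m ≤ suc n

level? : ∀ n m → Dec (Level n m)
level? n m = n ≤? m ×-dec m ≤? suc n

onLevel : ∀ {n} → ℕ → Subset n → Bool
onLevel {n} a A = does (level? n (∣ A ∣ + ∣ A ∣ + a))

onLevel-sound : ∀ {n} a (A : Subset n) → onLevel a A ≡ true → Level n (∣ A ∣ + ∣ A ∣ + a)
onLevel-sound {n} a A h =
  toWitness (Equivalence.from T-≡ (trans (isYes≗does (level? n (∣ A ∣ + ∣ A ∣ + a))) h))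

Level-suc : ∀ {n m} → Level (suc n) (suc m) ⇔ Level n m
Level-suc = mk⇔ (Product.map s≤s⁻¹ s≤s⁻¹) (Product.map s≤s s≤s)

onLevel-∷ʳ-false : ∀ {n} a (A : Subset n) → onLevel (suc a) (A ∷ʳ false) ≡ onLevel a A
onLevel-∷ʳ-false {n} a A rewrite ∣∷ʳfalse∣ A | +-suc (∣ A ∣ + ∣ A ∣) a =
  does-⇔ Level-suc (level? (suc n) (suc (∣ A ∣ + ∣ A ∣ + a))) (level? n (∣ A ∣ + ∣ A ∣ + a))

onLevel-∷ʳ-true : ∀ {n} a (A : Subset n) → onLevel a (A ∷ʳ true) ≡ onLevel (suc a) A
onLevel-∷ʳ-true {n} a A rewrite ∣∷ʳtrue∣ A | +-suc ∣ A ∣ ∣ A ∣ | +-suc (∣ A ∣ + ∣ A ∣) a =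
  does-⇔ Level-suc (level? (suc n) (suc (suc (∣ A ∣ + ∣ A ∣ + a)))) (level? n (suc (∣ A ∣ + ∣ A ∣ + a)))

Level-∁ : ∀ c s → Level (suc (c + s)) (c + c + 0) ⇔ Level (c + s) (s + s + 2)
Level-∁ c s = mk⇔ (λ (lo , hi) → from e₄ (to e₃ hi) , from e₂ (to e₁ lo))
                  (λ (lo , hi) → from e₁ (to e₂ hi) , from e₃ (to e₄ lo))
  where
  open Equivalence
  twice+2 : ∀ s → s + s + 2 ≡ suc s + suc s
  twice+2 = solve-∀
  twice+2′ : ∀ s → s + s + 2 ≡ suc (suc s) + s
  twice+2′ = solve-∀
  cancelˡ : ∀ x {y z u v} → u ≡ x + y → v ≡ x + z → u ≤ v ⇔ y ≤ z
  cancelˡ x refl refl = mk⇔ (+-cancelˡ-≤ x _ _) (+-monoʳ-≤ x)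
  cancelʳ : ∀ x {y z u v} → u ≡ y + x → v ≡ z + x → u ≤ v ⇔ y ≤ z
  cancelʳ x refl refl = mk⇔ (+-cancelʳ-≤ x _ _) (+-monoˡ-≤ x)
  e₁ : suc (c + s) ≤ c + c + 0 ⇔ suc s ≤ c
  e₁ = cancelˡ c (sym (+-suc c s)) (+-identityʳ (c + c))
  e₂ : s + s + 2 ≤ suc (c + s) ⇔ suc s ≤ c
  e₂ = cancelʳ (suc s) (twice+2 s) (sym (+-suc c s))
  e₃ : c + c + 0 ≤ suc (suc (c + s)) ⇔ c ≤ suc (suc s)
  e₃ = cancelˡ c (+-identityʳ (c + c)) (sym (trans (+-suc c (suc s)) (cong suc (+-suc c s))))
  e₄ : c + s ≤ s + s + 2 ⇔ c ≤ suc (suc s)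
  e₄ = cancelʳ s refl (twice+2′ s)

level-∁ : ∀ {n} c s → c + s ≡ n → does (level? (suc n) (c + c + 0)) ≡ does (level? n (s + s + 2))
level-∁ c s refl = does-⇔ (Level-∁ c s) (level? _ (c + c + 0)) (level? (c + s) (s + s + 2))

#onLevel : ℕ → ℕ → ℕ
#onLevel n a = countSubsets n (onLevel a)

#onLevel-suc : ∀ n a → #onLevel (suc n) (suc a) ≡ #onLevel n a + #onLevel n (suc (suc a))
#onLevel-suc n a = trans (countSubsets-∷ʳ n (onLevel (suc a)))
  (cong₂ _+_ (countSubsets-cong n (onLevel-∷ʳ-false a)) (countSubsets-cong n (onLevel-∷ʳ-true (suc a))))

-- The lower half of the offset-0 level would need offset −1; complementation maps it onto offset 2.
#onLevel-zero : ∀ n → #onLevel (suc n) 0 ≡ #onLevel n 2 + #onLevel n 1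
#onLevel-zero n = trans (countSubsets-∷ʳ n (onLevel 0))
  (cong₂ _+_ lowerHalf≡ (countSubsets-cong n (onLevel-∷ʳ-true 0)))
  where
  upperMiddle : Subset n → Bool
  upperMiddle A = does (level? (suc n) (∣ A ∣ + ∣ A ∣ + 0))
  lowerHalf≡ : countSubsets n (λ A → onLevel 0 (A ∷ʳ false)) ≡ #onLevel n 2
  lowerHalf≡ = begin
    countSubsets n (λ A → onLevel 0 (A ∷ʳ false))
      ≡⟨ countSubsets-cong n (λ A → cong (λ k → does (level? (suc n) (k + k + 0))) (∣∷ʳfalse∣ A)) ⟩
    countSubsets n upperMiddle
      ≡⟨ sym (countSubsets-∁ n upperMiddle) ⟩
    countSubsets n (λ A → upperMiddle (∁ A))
      ≡⟨ countSubsets-cong n (λ A → level-∁ ∣ ∁ A ∣ ∣ A ∣ (∣∁A∣+∣A∣≡n A)) ⟩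
    #onLevel n 2 ∎
    where open ≡-Reasoning

#onLevel≡#special≥ : ∀ n a → #onLevel n a ≡ #special≥ n (a ∸ 1)
#onLevel≡#special≥ zero    zero          = refl
#onLevel≡#special≥ zero    (suc zero)    = refl
#onLevel≡#special≥ zero    (suc (suc a)) = refl
#onLevel≡#special≥ (suc n) zero = begin
  #onLevel (suc n) 0                 ≡⟨ #onLevel-zero n ⟩
  #onLevel n 2 + #onLevel n 1        ≡⟨ cong₂ _+_ (#onLevel≡#special≥ n 2) (#onLevel≡#special≥ n 1) ⟩
  #special≥ n 1 + #special≥ n 0      ≡⟨ +-comm (#special≥ n 1) (#special≥ n 0) ⟩
  #special≥ n 0 + #special≥ n 1      ≡⟨ sym (#special≥-suc n 0) ⟩
  #special≥ (suc n) 0                ∎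
  where open ≡-Reasoning
#onLevel≡#special≥ (suc n) (suc a) = begin
  #onLevel (suc n) (suc a)                   ≡⟨ #onLevel-suc n a ⟩
  #onLevel n a + #onLevel n (suc (suc a))    ≡⟨ cong₂ _+_ (#onLevel≡#special≥ n a)
                                                           (#onLevel≡#special≥ n (suc (suc a))) ⟩
  #special≥ n (a ∸ 1) + #special≥ n (suc a)  ≡⟨ sym (#special≥-suc n a) ⟩
  #special≥ (suc n) a                        ∎
  where open ≡-Reasoning

twice-< : ∀ {k l} a → k < l → suc (k + k + a) < l + l + a
twice-< {k} a k<l = ≤-trans (≤-reflexive (cong (λ t → suc (t + a)) (sym (+-suc k k))))
                            (+-monoˡ-≤ a (+-mono-≤ k<l k<l))

Level-twice-≤ : ∀ {n a k l} → Level n (k + k + a) → Level n (l + l + a) → l ≤ k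
Level-twice-≤ {n} {a} {k} {l} (n≤ , _) (_ , ≤1+n) = ≮⇒≥ λ k<l → <-irrefl refl (begin-strict
  suc n            ≤⟨ s≤s n≤ ⟩
  suc (k + k + a)  <⟨ twice-< a k<l ⟩
  l + l + a        ≤⟨ ≤1+n ⟩
  suc n            ∎)
  where open ≤-Reasoning

onLevel-⊆⇒≡ : ∀ {n} a {A B : Subset n} → onLevel a A ≡ true → onLevel a B ≡ true → A ⊆ B → A ≡ B
onLevel-⊆⇒≡ a {A} {B} A∈L B∈L A⊆B =
  ⊆∧∣∣≥⇒≡ A⊆B (Level-twice-≤ (onLevel-sound a A A∈L) (onLevel-sound a B B∈L))

-- Lower bound: an antichain of size s(D)

-- ∅1 is the least set outside the lower half, so D either contains the whole lower half
-- or misses the upper one.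
antichain : ∀ {n} → ℕ → Family n → Family n
antichain {zero}  a D A = D A ∧ (a ≡ᵇ 0)
antichain {suc n} a D =
  if D (∅ ∷ʳ true)
  then caseLast (onLevel a) (antichain (suc a) (upperHalf D))
  else caseLast (antichain (a ∸ 1) (lowerHalf D)) (λ _ → false)

≡ᵇ0≡≤ᵇ0 : ∀ a → (a ≡ᵇ 0) ≡ (a ≤ᵇ 0)
≡ᵇ0≡≤ᵇ0 zero    = refl
≡ᵇ0≡≤ᵇ0 (suc a) = refl

#antichain : ∀ {n} a {D : Family n} → InitialSegment D → countSubsets n (antichain a D) ≡ #special≥In a D
#antichain {zero} a {D} _ =
  countSubsets-cong 0 {antichain a D} {λ A → D A ∧ special≥ a A} λ { [] → cong (D [] ∧_) (≡ᵇ0≡≤ᵇ0 a) }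
#antichain {suc n} a {D} D-init with D (∅ ∷ʳ true) in ∅₁∈D
... | true = begin
  countSubsets (suc n) (caseLast (onLevel a) (antichain (suc a) (upperHalf D)))
    ≡⟨ countSubsets-caseLast n (onLevel a) (antichain (suc a) (upperHalf D)) ⟩
  #onLevel n a + countSubsets n (antichain (suc a) (upperHalf D))
    ≡⟨ cong₂ _+_ (#onLevel≡#special≥ n a) (#antichain (suc a) (upperHalf-initial D-init)) ⟩
  #special≥ n (a ∸ 1) + #special≥In (suc a) (upperHalf D)
    ≡⟨ cong (_+ #special≥In (suc a) (upperHalf D))
            (sym (#special≥In-full (a ∸ 1) (lowerHalf D) (lowerHalf-full D-init ∅₁∈D))) ⟩
  #special≥In (a ∸ 1) (lowerHalf D) + #special≥In (suc a) (upperHalf D)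
    ≡⟨ sym (#special≥In-suc a D) ⟩
  #special≥In a D ∎
  where open ≡-Reasoning
... | false = begin
  countSubsets (suc n) (caseLast (antichain (a ∸ 1) (lowerHalf D)) (λ _ → false))
    ≡⟨ countSubsets-caseLast n (antichain (a ∸ 1) (lowerHalf D)) (λ _ → false) ⟩
  countSubsets n (antichain (a ∸ 1) (lowerHalf D)) + countSubsets n (λ _ → false)
    ≡⟨ cong₂ _+_ (#antichain (a ∸ 1) (lowerHalf-initial D-init))
                 (trans (count-false (allSubsets n))
                        (sym (#special≥In-empty (suc a) (upperHalf D) (upperHalf-empty D-init ∅₁∈D)))) ⟩
  #special≥In (a ∸ 1) (lowerHalf D) + #special≥In (suc a) (upperHalf D)
    ≡⟨ sym (#special≥In-suc a D) ⟩
  #special≥In a D ∎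
  where open ≡-Reasoning

antichain⊆D : ∀ {n} a {D : Family n} → InitialSegment D → ∀ A → antichain a D A ≡ true → D A ≡ true
antichain⊆D {zero} a {D} _ [] h with D []
... | true  = refl
... | false = h
antichain⊆D {suc n} a {D} D-init A h with D (∅ ∷ʳ true) in ∅₁∈D | initLast A
... | true  | A′ , false , refl = lowerHalf-full D-init ∅₁∈D A′
... | true  | A′ , true  , refl = antichain⊆D (suc a) (upperHalf-initial D-init) A′
  (caseLast-true (onLevel a) (antichain (suc a) (upperHalf D)) A′ h)
... | false | A′ , false , refl = antichain⊆D (a ∸ 1) (lowerHalf-initial D-init) A′
  (caseLast-false (antichain (a ∸ 1) (lowerHalf D)) (λ _ → false) A′ h)
... | false | A′ , true  , refl with caseLast-true (antichain (a ∸ 1) (lowerHalf D)) (λ _ → false) A′ h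
...   | ()

antichain-rank : ∀ {n} a (D : Family n) A → antichain a D A ≡ true → ∣ A ∣ + ∣ A ∣ + a ≤ n
antichain-rank {zero} zero    D [] _ = z≤n
antichain-rank {zero} (suc a) D [] h with D []
antichain-rank {zero} (suc a) D [] () | true
antichain-rank {zero} (suc a) D [] () | false
antichain-rank {suc n} a D A h with D (∅ ∷ʳ true) | initLast A
... | true  | A′ , false , refl rewrite ∣∷ʳfalse∣ A′ =
  proj₂ (onLevel-sound a A′ (caseLast-false (onLevel a) (antichain (suc a) (upperHalf D)) A′ h))
... | true  | A′ , true  , refl rewrite ∣∷ʳtrue∣ A′ | +-suc ∣ A′ ∣ ∣ A′ ∣ = s≤s (begin
  suc (∣ A′ ∣ + ∣ A′ ∣) + a    ≡⟨ sym (+-suc (∣ A′ ∣ + ∣ A′ ∣) a) ⟩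
  ∣ A′ ∣ + ∣ A′ ∣ + suc a      ≤⟨ antichain-rank (suc a) (upperHalf D) A′
                                    (caseLast-true (onLevel a) (antichain (suc a) (upperHalf D)) A′ h) ⟩
  n                            ∎)
  where open ≤-Reasoning
... | false | A′ , false , refl rewrite ∣∷ʳfalse∣ A′ = begin
  ∣ A′ ∣ + ∣ A′ ∣ + a          ≤⟨ +-monoʳ-≤ (∣ A′ ∣ + ∣ A′ ∣) (m≤n+m∸n a 1) ⟩
  ∣ A′ ∣ + ∣ A′ ∣ + suc (a ∸ 1) ≡⟨ +-suc (∣ A′ ∣ + ∣ A′ ∣) (a ∸ 1) ⟩
  suc (∣ A′ ∣ + ∣ A′ ∣ + (a ∸ 1)) ≤⟨ s≤s (antichain-rank (a ∸ 1) (lowerHalf D) A′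
                                    (caseLast-false (antichain (a ∸ 1) (lowerHalf D)) (λ _ → false) A′ h)) ⟩
  suc n                         ∎
  where open ≤-Reasoning
... | false | A′ , true  , refl with caseLast-true (antichain (a ∸ 1) (lowerHalf D)) (λ _ → false) A′ h
...   | ()

onLevel-⊈antichain : ∀ {n} a (D : Family n) {A B} →
  onLevel a A ≡ true → antichain (suc a) D B ≡ true → ¬ (A ⊆ B)
onLevel-⊈antichain {n} a D {A} {B} A∈L B∈T A⊆B = <-irrefl refl (begin-strict
  ∣ A ∣ + ∣ A ∣ + a     ≤⟨ +-monoˡ-≤ a (+-mono-≤ ∣A∣≤∣B∣ ∣A∣≤∣B∣) ⟩
  ∣ B ∣ + ∣ B ∣ + a     <⟨ ≤-reflexive (sym (+-suc (∣ B ∣ + ∣ B ∣) a)) ⟩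
  ∣ B ∣ + ∣ B ∣ + suc a ≤⟨ antichain-rank (suc a) D B B∈T ⟩
  n                     ≤⟨ proj₁ (onLevel-sound a A A∈L) ⟩
  ∣ A ∣ + ∣ A ∣ + a     ∎)
  where
  open ≤-Reasoning
  ∣A∣≤∣B∣ : ∣ A ∣ ≤ ∣ B ∣
  ∣A∣≤∣B∣ = p⊆q⇒∣p∣≤∣q∣ A⊆B

antichain-⊆⇒≡ : ∀ {n} a (D : Family n) {A B} →
  antichain a D A ≡ true → antichain a D B ≡ true → A ⊆ B → A ≡ B
antichain-⊆⇒≡ {zero} a D {[]} {[]} _ _ _ = refl
antichain-⊆⇒≡ {suc n} a D {A} {B} A∈ B∈ A⊆B with D (∅ ∷ʳ true) | initLast A | initLast B
... | true | A′ , x , refl | B′ , y , refl = go x y A∈ B∈ (∷ʳ-⊆-∷ʳ⁻ A⊆B)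
  where
  F G : Family n
  F = onLevel a
  G = antichain (suc a) (upperHalf D)
  go : ∀ x y → caseLast F G (A′ ∷ʳ x) ≡ true → caseLast F G (B′ ∷ʳ y) ≡ true →
       A′ ⊆ B′ × x Bool.≤ y → A′ ∷ʳ x ≡ B′ ∷ʳ y
  go false false A∈ B∈ (A′⊆B′ , _) =
    cong (_∷ʳ false) (onLevel-⊆⇒≡ a (caseLast-false F G A′ A∈) (caseLast-false F G B′ B∈) A′⊆B′)
  go true true A∈ B∈ (A′⊆B′ , _) =
    cong (_∷ʳ true) (antichain-⊆⇒≡ (suc a) (upperHalf D)
                      (caseLast-true F G A′ A∈) (caseLast-true F G B′ B∈) A′⊆B′)
  go false true A∈ B∈ (A′⊆B′ , _) =
    ⊥-elim (onLevel-⊈antichain a (upperHalf D) (caseLast-false F G A′ A∈) (caseLast-true F G B′ B∈) A′⊆B′)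
  go true false _ _ (_ , ())
... | false | A′ , x , refl | B′ , y , refl = go x y A∈ B∈ (∷ʳ-⊆-∷ʳ⁻ A⊆B)
  where
  F G : Family n
  F = antichain (a ∸ 1) (lowerHalf D)
  G _ = false
  go : ∀ x y → caseLast F G (A′ ∷ʳ x) ≡ true → caseLast F G (B′ ∷ʳ y) ≡ true →
       A′ ⊆ B′ × x Bool.≤ y → A′ ∷ʳ x ≡ B′ ∷ʳ y
  go false false A∈ B∈ (A′⊆B′ , _) =
    cong (_∷ʳ false) (antichain-⊆⇒≡ (a ∸ 1) (lowerHalf D)
                       (caseLast-false F G A′ A∈) (caseLast-false F G B′ B∈) A′⊆B′)
  go true  _ A∈ _ _ with caseLast-true F G A′ A∈
  ... | ()
  go false true _ B∈ _ with caseLast-true F G B′ B∈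
  ... | ()

filter-antichain : ∀ {n} (D F : Family n) → (∀ A → F A ≡ true → D A ≡ true) →
  (∀ {A B} → F A ≡ true → F B ≡ true → A ⊆ B → A ≡ B) →
  IsAntichainIn D (filter (λ A → F A ≟ᵇ true) (allSubsets n))
filter-antichain {n} D F F⊆D F-⊆ =
  All.map (F⊆D _) members ,
  AllPairs-mapWithAll incomparable members (Uniqueₚ.filter⁺ (λ A → F A ≟ᵇ true) (allSubsets-unique n))
  where
  members : All (λ A → F A ≡ true) (filter (λ A → F A ≟ᵇ true) (allSubsets n))
  members = all-filter (λ A → F A ≟ᵇ true) (allSubsets n)
  incomparable : ∀ {A B} → F A ≡ true → F B ≡ true → A ≢ B → Incomparable A B
  incomparable A∈F B∈F A≢B =
    (λ A⊆B → A≢B (F-⊆ A∈F B∈F A⊆B)) , (λ B⊆A → A≢B (sym (F-⊆ B∈F A∈F B⊆A)))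

lemma5 : (n : ℕ) (D : Family n) → InitialSegment D → IsWidth D (s D)
lemma5 n D D-init =
  (filter (λ A → antichain 0 D A ≟ᵇ true) (allSubsets n) ,
   filter-antichain D (antichain 0 D) (antichain⊆D 0 D-init) (antichain-⊆⇒≡ 0 D) ,
   trans (#antichain 0 D-init) (countSubsets-cong n (λ A → cong (D A ∧_) (special≥-zero A)))) ,
  antichain-length≤s D-init
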